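{- Let $n\ge 2$ and let $\mathcal{A}$ be an antichain in $Q(P_n)$. Then there exists an antichain $\mathcal{A}'$ contained in \[ Q'(P_n)=\bigcup_{\frac{n-1}{4}<r<\frac{n+2}{3}} Q^{(r)}(P_n) \] with $|\mathcal{A}|\le|\mathcal{A}'|$.
   Context: $Q(P_n)$ is the collection of subsets of $[n]=\{1,\dots,n\}$ containing no two consecutive integers (independent sets of the path $P_n$), ordered by inclusion; $Q^{(r)}(P_n)$ is the set of its members of size $r$. An antichain is a family no member of which is a subset of another. -}

module Defs where

open import Data.Nat using (ℕ; suc; _+_; _*_; _<_)
open import Data.Fin using (Fin; toℕ)
open import Data.Fin.Subset using (Subset; _∈_; _⊆_; ∣_∣)
open import Data.List using (List; length)
open import Data.List.Relation.Unary.All using (All)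
open import Data.List.Relation.Unary.Unique.Propositional using (Unique)
import Data.List.Membership.Propositional as L
open import Data.Product using (_×_)
open import Relation.Binary.PropositionalEquality using (_≡_)
open import Data.Empty using (⊥)

-- Subsets of [n] are encoded as Subset n (characteristic vectors over Fin n);
-- element i : Fin n stands for the integer toℕ i + 1.

-- A is an independent set of the path P_n: no two consecutive integers.
Independent : ∀ {n} → Subset n → Set
Independent {n} A = (i j : Fin n) → toℕ j ≡ suc (toℕ i) → i ∈ A → j ∈ A → ⊥

-- A family (a finite set of subsets) is a duplicate-free list; |F| = length F.
-- F is a family in Q(P_n):
InQ : ∀ n → List (Subset n) → Set
InQ n F = Unique F × All Independent F

Antichain : ∀ {n} → List (Subset n) → Set
Antichain F = ∀ {A B} → A L.∈ F → B L.∈ F → A ⊆ B → A ≡ B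

-- r lies in the range (n-1)/4 < r < (n+2)/3 (cleared denominators; exact over ℕ:
-- (n-1)/4 < r  ⇔  n < 4r + 1,   r < (n+2)/3  ⇔  3r < n + 2).
MiddleLayer : ℕ → ℕ → Set
MiddleLayer n r = (n < 4 * r + 1) × (3 * r < n + 2)

InQ' : ∀ n → Subset n → Set
InQ' n A = Independent A × MiddleLayer n ∣ A ∣

-- An antichain is moved into the middle layers one extreme layer at a time.  If layer r of Q(P_n)
-- maps injectively into layer r - 1 (resp. r + 1), each set to a subset (resp. superset) of itself,
-- then replacing the members of the top (resp. bottom) layer of an antichain by their images gives
-- an antichain of the same size.  Such maps exist when 3r ≥ n + 2 (resp. 4r + 1 ≤ n).  To build
-- them, append the absent vertex n + 1 to an independent set of size r, cut its characteristic word
-- into pieces pick = 10 and skip = 0, and read these as the steps of a lattice walk.  Going down,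
-- pick and skip weigh +1 and -1, the walk ends at height 3r - (n + 1) ≥ 1, and the pick by which it
-- first reaches its maximum becomes skip skip.  Going up, they weigh -2 and +1, the walk ends at
-- n + 1 - 4r ≥ 2, and the two skips by which it first reaches its maximum become a pick.  Either way
-- the new pieces fall at least as far as the old ones rose, so the replaced position can be
-- recovered from the image and the maps are injective.
module Submission where

open import Defs
open import Data.Bool using (true; false)
open import Data.Empty using (⊥; ⊥-elim)
open import Data.Fin using (zero; suc)
open import Data.Fin.Subset using (Subset; _⊆_; _⊇_; ∣_∣)
open import Data.Fin.Subset.Properties using (⊆-refl; ⊆-trans; out⊆; s⊆s; drop-∷-⊆; p⊆q⇒∣p∣≤∣q∣; ∣p∣≤n)
open import Data.List using (List; []; _∷_; _++_; _∷ʳ_; initLast; _∷ʳ′_; length; map; filter)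
open import Data.List.Properties
  using (∷-injective; ∷-injectiveˡ; ∷-injectiveʳ; ++-assoc; ++-identityʳ; ++-cancelˡ; ++-conicalˡ; ++-conicalʳ;
         length-++; length-map)
open import Data.List.Membership.Propositional using (_∈_)
open import Data.List.Membership.Propositional.Properties using (∈-filter⁻; ∈-map⁻; ∈-++⁻)
open import Data.List.Relation.Unary.All as All using (All; []; _∷_)
import Data.List.Relation.Unary.All.Properties as All
open import Data.List.Relation.Unary.Unique.Propositional using (Unique; []; _∷_)
import Data.List.Relation.Unary.Unique.Propositional.Properties as Unique
open import Data.Nat as ℕ using (ℕ; zero; suc)
open import Data.Product using (Σ; ∃; ∃₂; _×_; _,_; proj₁; proj₂)
open import Data.Sum using (_⊎_; inj₁; inj₂)
open import Data.Vec using ([]; _∷_; here; there)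
open import Function using (_∘_)
open import Relation.Nullary using (¬_; yes; no; contradiction)
open import Relation.Unary using (Decidable)
open import Relation.Unary.Properties using (∁?)
open import Relation.Binary.PropositionalEquality using (_≡_; _≢_; refl; sym; trans; cong; cong₂; subst)

++-equidivisible : ∀ {A : Set} (p t : List A) {q r} → p ++ q ≡ t ++ r →
  (∃ λ x → p ++ x ≡ t × x ++ r ≡ q) ⊎ (∃ λ x → t ++ x ≡ p × x ++ q ≡ r)
++-equidivisible []      t       eq = inj₁ (t , refl , sym eq)
++-equidivisible (a ∷ p) []      eq = inj₂ (a ∷ p , refl , eq)
++-equidivisible (a ∷ p) (b ∷ t) eq with refl , eq′ ← ∷-injective eq with ++-equidivisible p t eq′
... | inj₁ (x , px≡t , xr≡q) = inj₁ (x , cong (a ∷_) px≡t , xr≡q)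
... | inj₂ (x , tx≡p , xq≡r) = inj₂ (x , cong (a ∷_) tx≡p , xq≡r)

unsnoc : ∀ {A : Set} (xs : List A) → xs ≢ [] → ∃₂ λ u x → u ∷ʳ x ≡ xs
unsnoc xs xs≢[] with initLast xs
... | []      = ⊥-elim (xs≢[] refl)
... | u ∷ʳ′ x = u , x , refl

++∷≢[] : ∀ {A : Set} (u : List A) {x v} → u ++ x ∷ v ≢ []
++∷≢[] []      ()
++∷≢[] (_ ∷ _) ()

module Walks where

  open import Data.Integer using (ℤ; 0ℤ; _+_; -_; _≤_; _<_; _<?_)
  open import Data.Integer.Properties
    using (≤-refl; ≤-reflexive; ≤-trans; <-≤-trans; <⇒≤; <⇒≱; ≮⇒≥; ≰⇒>; +-identityˡ; +-identityʳ; +-assoc;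
           +-inverseˡ; +-monoʳ-≤; +-monoʳ-<; +-mono-≤; +-commutativeSemigroup; module ≤-Reasoning)
  open import Algebra.Properties.CommutativeSemigroup +-commutativeSemigroup using (xy∙z≈xz∙y)

  +-cancelˡ-≤ : ∀ a {b c} → a + b ≤ a + c → b ≤ c
  +-cancelˡ-≤ a {b} {c} a+b≤a+c = begin
    b              ≡⟨ sym (-a+[a+x]≡x b) ⟩
    - a + (a + b)  ≤⟨ +-monoʳ-≤ (- a) a+b≤a+c ⟩
    - a + (a + c)  ≡⟨ -a+[a+x]≡x c ⟩
    c              ∎
    where
    open ≤-Reasoning
    -a+[a+x]≡x : ∀ x → - a + (a + x) ≡ x
    -a+[a+x]≡x x = trans (sym (+-assoc (- a) a x)) (trans (cong (_+ x) (+-inverseˡ a)) (+-identityˡ x))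

  increment-positive : ∀ a b → a < a + b → 0ℤ < b
  increment-positive a b a<a+b = ≰⇒> λ b≤0 → <⇒≱ a<a+b (begin
    a + b   ≤⟨ +-monoʳ-≤ a b≤0 ⟩
    a + 0ℤ  ≡⟨ +-identityʳ a ⟩
    a       ∎)
    where open ≤-Reasoning

  module Walk {X : Set} (w : X → ℤ) where

    height : List X → ℤ
    height []      = 0ℤ
    height (x ∷ t) = w x + height t

    height-++ : ∀ p q → height (p ++ q) ≡ height p + height q
    height-++ []      q = sym (+-identityˡ (height q))
    height-++ (x ∷ p) q = trans (cong (w x +_) (height-++ p q)) (sym (+-assoc (w x) (height p) (height q)))

    Below : ℤ → List X → Set
    Below c t = ∀ p q → p ++ q ≡ t → height p ≤ c

    record Summit (t : List X) : Set where
      constructor summitAt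
      field
        top rest : List X
        split    : top ++ rest ≡ t
        rising   : ∀ p q → p ++ q ≡ top → q ≢ [] → height p < height top
        falling  : Below 0ℤ rest

    module _ {t} (S : Summit t) where
      open Summit S

      summit-highest : Below (height top) t
      summit-highest p q eq with ++-equidivisible p top (trans eq (sym split))
      ... | inj₁ ([] , p++[]≡top , _) =
        ≤-reflexive (cong height (trans (sym (++-identityʳ p)) p++[]≡top))
      ... | inj₁ (x@(_ ∷ _) , p++x≡top , _) = <⇒≤ (rising p x p++x≡top λ ())
      ... | inj₂ (x , top++x≡p , x++q≡rest) = begin
        height p               ≡⟨ cong height (sym top++x≡p) ⟩
        height (top ++ x)      ≡⟨ height-++ top x ⟩
        height top + height x  ≤⟨ +-monoʳ-≤ (height top) (falling x q x++q≡rest) ⟩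
        height top + 0ℤ        ≡⟨ +-identityʳ (height top) ⟩
        height top             ∎
        where open ≤-Reasoning

      summit-peak : height t ≤ height top
      summit-peak = summit-highest t [] (++-identityʳ t)

      summit-nonempty : 0ℤ < height t → top ≢ []
      summit-nonempty 0<t top≡[] = <⇒≱ 0<t (≤-trans summit-peak (≤-reflexive (cong height top≡[])))

      summit-final-rise : ∀ u v → u ++ v ≡ top → v ≢ [] → 0ℤ < height v
      summit-final-rise u v eq v≢[] =
        increment-positive (height u) (height v)
          (<-≤-trans (rising u v eq v≢[]) (≤-reflexive (trans (cong height (sym eq)) (height-++ u v))))

    summit : ∀ t → Summit t
    summit []      = summitAt [] [] refl (λ p q eq → contradiction (++-conicalʳ p q eq))
                                        (λ p q eq → ≤-reflexive (cong height (++-conicalˡ p q eq)))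
    summit (x ∷ t) = prepend (summit t)
      where
      prepend : Summit t → Summit (x ∷ t)
      prepend S@(summitAt top rest split rising falling) with 0ℤ <? w x + height top
      ... | yes climbs = summitAt (x ∷ top) rest (cong (x ∷_) split) rising∷ falling
        where
        rising∷ : ∀ p q → p ++ q ≡ x ∷ top → q ≢ [] → height p < w x + height top
        rising∷ []      _ _  _    = climbs
        rising∷ (_ ∷ p) q eq q≢[] with refl , eq′ ← ∷-injective eq =
          +-monoʳ-< (w x) (rising p q eq′ q≢[])
      ... | no ¬climbs =
        summitAt [] (x ∷ t) refl (λ p q eq → contradiction (++-conicalʳ p q eq)) falling∷
        where
        falling∷ : Below 0ℤ (x ∷ t)
        falling∷ []      _ _  = ≤-refl
        falling∷ (_ ∷ p) q eq with refl , eq′ ← ∷-injective eq =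
          ≤-trans (+-monoʳ-≤ (w x) (summit-highest S p q eq′)) (≮⇒≥ ¬climbs)

    record Ascent (s t : List X) : Set where
      constructor ascentAt
      field
        before after : List X
        split        : before ++ s ++ after ≡ t
        rising       : ∀ p q → p ++ q ≡ before → height p < height before + height s
        falling      : Below 0ℤ after

    summit⇒ascent : ∀ {s t} (S : Summit t) → s ≢ [] → ∀ {u} → u ++ s ≡ Summit.top S → Ascent s t
    summit⇒ascent {s} {t} (summitAt top rest split rising falling) s≢[] {u} u++s≡top =
      ascentAt u rest (trans (sym (++-assoc u s rest)) (trans (cong (_++ rest) u++s≡top) split))
               rising′ falling
      where
      rising′ : ∀ p q → p ++ q ≡ u → height p < height u + height s
      rising′ p q p++q≡u =
        <-≤-trans (rising p (q ++ s) p++qs≡top λ qs≡[] → s≢[] (++-conicalʳ q s qs≡[]))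
                  (≤-reflexive (trans (cong height (sym u++s≡top)) (height-++ u s)))
        where p++qs≡top = trans (sym (++-assoc p q s)) (trans (cong (_++ s) p++q≡u) u++s≡top)

    _⟨_⟩ : ∀ {s t} → Ascent s t → List X → List X
    A ⟨ r ⟩ = Ascent.before A ++ r ++ Ascent.after A

    Sinks : List X → List X → Set
    Sinks s r = ∀ x y → x ++ y ≡ r → x ≢ [] → height x + height s ≤ 0ℤ

    module _ {s r : List X} (r≢[] : r ≢ []) (sinks : Sinks s r) where

      private
        no-later-ascent : ∀ {t₁ t₂} (A₁ : Ascent s t₁) (A₂ : Ascent s t₂) {x} →
          Ascent.before A₁ ++ x ≡ Ascent.before A₂ →
          x ++ r ++ Ascent.after A₂ ≡ r ++ Ascent.after A₁ → x ≡ []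
        no-later-ascent _ _ {[]} _ _ = refl
        no-later-ascent (ascentAt u₁ _ _ _ falling₁) (ascentAt u₂ _ _ rising₂ _) {x@(_ ∷ _)} u₁x≡u₂ eq =
          contradiction descent (<⇒≱ ascent)
          where
          ascent : 0ℤ < height x + height s
          ascent = increment-positive (height u₁) (height x + height s) (begin-strict
            height u₁                          <⟨ rising₂ u₁ x u₁x≡u₂ ⟩
            height u₂ + height s               ≡⟨ cong (λ z → height z + height s) (sym u₁x≡u₂) ⟩
            height (u₁ ++ x) + height s        ≡⟨ cong (_+ height s) (height-++ u₁ x) ⟩
            height u₁ + height x + height s    ≡⟨ +-assoc (height u₁) (height x) (height s) ⟩
            height u₁ + (height x + height s)  ∎)
            where open ≤-Reasoning
          descent : height x + height s ≤ 0ℤ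
          descent with ++-equidivisible x r eq
          ... | inj₁ (y , x++y≡r , _)  = sinks x y x++y≡r λ ()
          ... | inj₂ (y , r++y≡x , y++rv₂≡v₁) = begin
            height x + height s              ≡⟨ cong (λ z → height z + height s) (sym r++y≡x) ⟩
            height (r ++ y) + height s       ≡⟨ cong (_+ height s) (height-++ r y) ⟩
            height r + height y + height s   ≡⟨ xy∙z≈xz∙y (height r) (height y) (height s) ⟩
            height r + height s + height y   ≤⟨ +-mono-≤ (sinks r [] (++-identityʳ r) r≢[])
                                                            (falling₁ y _ y++rv₂≡v₁) ⟩
            0ℤ                               ∎
            where open ≤-Reasoning

        same-ascent : ∀ {t₁ t₂} (A₁ : Ascent s t₁) (A₂ : Ascent s t₂) {x} →
          Ascent.before A₁ ++ x ≡ Ascent.before A₂ →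
          x ++ r ++ Ascent.after A₂ ≡ r ++ Ascent.after A₁ → t₁ ≡ t₂
        same-ascent A₁@(ascentAt u₁ _ split₁ _ _) A₂@(ascentAt _ _ split₂ _ _) u₁x≡u₂ eq
          with refl ← no-later-ascent A₁ A₂ u₁x≡u₂ eq =
          trans (sym split₁) (trans (cong₂ (λ u v → u ++ s ++ v) (trans (sym (++-identityʳ u₁)) u₁x≡u₂)
                                                                  (sym (++-cancelˡ r _ _ eq))) split₂)

      ascent-injective : ∀ {t₁ t₂} (A₁ : Ascent s t₁) (A₂ : Ascent s t₂) →
        A₁ ⟨ r ⟩ ≡ A₂ ⟨ r ⟩ → t₁ ≡ t₂
      ascent-injective A₁ A₂ eq with ++-equidivisible (Ascent.before A₁) (Ascent.before A₂) eq
      ... | inj₁ (_ , u₁x≡u₂ , eq′) = same-ascent A₁ A₂ u₁x≡u₂ eq′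
      ... | inj₂ (_ , u₂x≡u₁ , eq′) = sym (same-ascent A₂ A₁ u₂x≡u₁ eq′)

    module Replace {s : List X} (r : List X) {P : List X → Set} (P? : Decidable P)
                   (ascent : ∀ {t} → P t → Ascent s t) where

      replace : List X → List X
      replace t with P? t
      ... | yes p = ascent p ⟨ r ⟩
      ... | no _  = t

      replace-ascent : ∀ {t} → P t → Σ (Ascent s t) λ A → replace t ≡ A ⟨ r ⟩
      replace-ascent {t} p with P? t
      ... | yes p′ = ascent p′ , refl
      ... | no ¬p  = contradiction p ¬p

      replace-injective : r ≢ [] → Sinks s r →
        ∀ {t₁ t₂} → P t₁ → P t₂ → replace t₁ ≡ replace t₂ → t₁ ≡ t₂
      replace-injective r≢[] sinks p₁ p₂ eq
        with A₁ , eq₁ ← replace-ascent p₁ | A₂ , eq₂ ← replace-ascent p₂ =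
        ascent-injective r≢[] sinks A₁ A₂ (trans (sym eq₁) (trans eq eq₂))

module IndependentSets where

  open Walks
  open import Data.Integer using (ℤ; +_; -[1+_]; 1ℤ; -1ℤ; _+_; _≤_; _≤?_; +≤+; -≤+; +<+)
  open import Data.Integer.Properties using (≤-reflexive; ≤-trans; <-≤-trans; module ≤-Reasoning)
  open import Data.Integer.Tactic.RingSolver using (solve-∀)
  open import Data.Nat.Properties using (suc-injective; *-suc; +-suc)
  import Relation.Binary.PropositionalEquality as ≡

  data Piece : Set where
    pick skip : Piece

  Word : Set
  Word = List Piece

  -- A subset of [n], with the absent vertex n + 1 appended, is cut into pieces: pick for the bits 10
  -- (a chosen vertex and its necessarily absent successor), skip for a single 0.  On a set that is
  -- not independent the bit after a chosen vertex is ignored.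
  word : ∀ {n} → Subset n → Word
  word []             = skip ∷ []
  word (false ∷ a)    = skip ∷ word a
  word (true ∷ [])    = pick ∷ []
  word (true ∷ _ ∷ a) = pick ∷ word a

  decode : ∀ n → Word → Subset n
  decode zero          _          = []
  decode (suc n)       []         = false ∷ decode n []
  decode (suc n)       (skip ∷ t) = false ∷ decode n t
  decode (suc zero)    (pick ∷ _) = true ∷ []
  decode (suc (suc n)) (pick ∷ t) = true ∷ false ∷ decode n t

  module _ {n} {a : Subset n} where

    independent-tail : ∀ {x} → Independent (x ∷ a) → Independent a
    independent-tail ind i j j≡1+i i∈ j∈ = ind (suc i) (suc j) (cong suc j≡1+i) (there i∈) (there j∈)

    independent-false∷ : Independent a → Independent (false ∷ a)
    independent-false∷ ind (suc i) (suc j) j≡1+i (there i∈) (there j∈) =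
      ind i j (suc-injective j≡1+i) i∈ j∈

    independent-true∷false∷ : Independent a → Independent (true ∷ false ∷ a)
    independent-true∷false∷ ind zero    (suc zero)    _ _ (there ())
    independent-true∷false∷ ind zero    (suc (suc _)) ()
    independent-true∷false∷ ind (suc i) (suc j)       j≡1+i (there i∈) (there j∈) =
      independent-false∷ ind i j (suc-injective j≡1+i) i∈ j∈

    independent-¬true∷true∷ : Independent (true ∷ true ∷ a) → ⊥
    independent-¬true∷true∷ ind = ind zero (suc zero) refl here (there here)

  independent-true∷[] : Independent (true ∷ [])
  independent-true∷[] zero zero ()

  decode-independent : ∀ n t → Independent (decode n t)
  decode-independent zero          _          ()
  decode-independent (suc n)       []         = independent-false∷ (decode-independent n [])
  decode-independent (suc n)       (skip ∷ t) = independent-false∷ (decode-independent n t)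
  decode-independent (suc zero)    (pick ∷ _) = independent-true∷[]
  decode-independent (suc (suc n)) (pick ∷ t) = independent-true∷false∷ (decode-independent n t)

  decode-word : ∀ {n} (a : Subset n) → Independent a → decode n (word a) ≡ a
  decode-word []                 _   = refl
  decode-word (false ∷ a)        ind = cong (false ∷_) (decode-word a (independent-tail ind))
  decode-word (true ∷ [])        _   = refl
  decode-word (true ∷ false ∷ a) ind =
    cong (λ b → true ∷ false ∷ b) (decode-word a (independent-tail (independent-tail ind)))
  decode-word (true ∷ true ∷ a)  ind = ⊥-elim (independent-¬true∷true∷ ind)

  shrink-flip : ∀ {n} (a : Subset n) → Independent a → ∀ u {v} → word a ≡ u ++ pick ∷ v →
    word (decode n (u ++ skip ∷ skip ∷ v)) ≡ u ++ skip ∷ skip ∷ v ×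
    decode n (u ++ skip ∷ skip ∷ v) ⊆ a × suc ∣ decode n (u ++ skip ∷ skip ∷ v) ∣ ≡ ∣ a ∣
  shrink-flip (true ∷ [])        _   []         eq with refl ← ∷-injectiveʳ eq = refl , out⊆ ⊆-refl , refl
  shrink-flip (true ∷ false ∷ a) ind []         eq with refl ← ∷-injectiveʳ eq
    rewrite decode-word a (independent-tail (independent-tail ind)) = refl , out⊆ ⊆-refl , refl
  shrink-flip (true ∷ false ∷ a) ind (pick ∷ u) eq
    with w≡ , b⊆a , size ← shrink-flip a (independent-tail (independent-tail ind)) u (∷-injectiveʳ eq) =
    cong (pick ∷_) w≡ , s⊆s (s⊆s b⊆a) , cong suc size
  shrink-flip (false ∷ a)        ind (skip ∷ u) eq
    with w≡ , b⊆a , size ← shrink-flip a (independent-tail ind) u (∷-injectiveʳ eq) =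
    cong (skip ∷_) w≡ , s⊆s b⊆a , size
  shrink-flip (true ∷ true ∷ a)  ind _          _  = ⊥-elim (independent-¬true∷true∷ ind)
  shrink-flip []                 _   []         eq with () ← ∷-injectiveˡ eq
  shrink-flip []                 _   (_ ∷ u)    eq = contradiction (sym (∷-injectiveʳ eq)) (++∷≢[] u)
  shrink-flip (false ∷ a)        _   []         eq with () ← ∷-injectiveˡ eq
  shrink-flip (false ∷ a)        _   (pick ∷ u) eq with () ← ∷-injectiveˡ eq
  shrink-flip (true ∷ [])        _   (_ ∷ u)    eq = contradiction (sym (∷-injectiveʳ eq)) (++∷≢[] u)
  shrink-flip (true ∷ false ∷ a) _   (skip ∷ u) eq with () ← ∷-injectiveˡ eq

  grow-flip : ∀ {n} (a : Subset n) → Independent a → ∀ u {v} → word a ≡ u ++ skip ∷ skip ∷ v →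
    word (decode n (u ++ pick ∷ v)) ≡ u ++ pick ∷ v ×
    a ⊆ decode n (u ++ pick ∷ v) × ∣ decode n (u ++ pick ∷ v) ∣ ≡ suc ∣ a ∣
  grow-flip (false ∷ [])         _   []         eq with refl ← ∷-injectiveʳ (∷-injectiveʳ eq) =
    refl , out⊆ ⊆-refl , refl
  grow-flip (false ∷ false ∷ a)  ind []         eq with refl ← ∷-injectiveʳ (∷-injectiveʳ eq)
    rewrite decode-word a (independent-tail (independent-tail ind)) = refl , out⊆ ⊆-refl , refl
  grow-flip (false ∷ a)          ind (skip ∷ u) eq
    with w≡ , a⊆b , size ← grow-flip a (independent-tail ind) u (∷-injectiveʳ eq) =
    cong (skip ∷_) w≡ , s⊆s a⊆b , size
  grow-flip (true ∷ false ∷ a)   ind (pick ∷ u) eq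
    with w≡ , a⊆b , size ← grow-flip a (independent-tail (independent-tail ind)) u (∷-injectiveʳ eq) =
    cong (pick ∷_) w≡ , s⊆s (s⊆s a⊆b) , cong suc size
  grow-flip (true ∷ true ∷ a)    ind _          _  = ⊥-elim (independent-¬true∷true∷ ind)
  grow-flip []                   _   []         eq with () ← ∷-injectiveʳ eq
  grow-flip []                   _   (_ ∷ u)    eq = contradiction (sym (∷-injectiveʳ eq)) (++∷≢[] u)
  grow-flip (false ∷ true ∷ [])  _   []         eq with () ← ∷-injectiveˡ (∷-injectiveʳ eq)
  grow-flip (false ∷ true ∷ _ ∷ _) _ []         eq with () ← ∷-injectiveˡ (∷-injectiveʳ eq)
  grow-flip (true ∷ [])          _   []         eq with () ← ∷-injectiveˡ eq
  grow-flip (true ∷ _ ∷ _)       _   []         eq with () ← ∷-injectiveˡ eq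
  grow-flip (false ∷ a)          _   (pick ∷ u) eq with () ← ∷-injectiveˡ eq
  grow-flip (true ∷ [])          _   (_ ∷ u)    eq = contradiction (sym (∷-injectiveʳ eq)) (++∷≢[] u)
  grow-flip (true ∷ false ∷ a)   _   (skip ∷ u) eq with () ← ∷-injectiveˡ eq

  shrinkWeight : Piece → ℤ
  shrinkWeight pick = 1ℤ
  shrinkWeight skip = -1ℤ

  growWeight : Piece → ℤ
  growWeight pick = -[1+ 1 ]
  growWeight skip = 1ℤ

  module Shrink = Walk shrinkWeight
  module Grow  = Walk growWeight

  shrink-height : ∀ {n} (a : Subset n) → Independent a → + suc n + Shrink.height (word a) ≡ + (3 ℕ.* ∣ a ∣)
  shrink-height []                 _   = refl
  shrink-height (true ∷ [])        _   = refl
  shrink-height {suc n} (false ∷ a) ind =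
    trans (step (+ suc n) (Shrink.height (word a))) (shrink-height a (independent-tail ind))
    where step : ∀ k h → (1ℤ + k) + (-1ℤ + h) ≡ k + h
          step = solve-∀
  shrink-height {suc (suc n)} (true ∷ false ∷ a) ind = begin
    + 2 + + suc n + (1ℤ + h)  ≡⟨ step (+ suc n) h ⟩
    + 3 + (+ suc n + h)       ≡⟨ cong (λ z → + 3 + z) (shrink-height a ind′) ⟩
    + (3 ℕ.+ 3 ℕ.* ∣ a ∣)     ≡⟨ cong +_ (sym (*-suc 3 ∣ a ∣)) ⟩
    + (3 ℕ.* suc ∣ a ∣)       ∎
    where
    open ≡.≡-Reasoning
    h = Shrink.height (word a)
    ind′ = independent-tail (independent-tail ind)
    step : ∀ k h → + 2 + k + (1ℤ + h) ≡ + 3 + (k + h)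
    step = solve-∀
  shrink-height (true ∷ true ∷ a) ind = ⊥-elim (independent-¬true∷true∷ ind)

  grow-height : ∀ {n} (a : Subset n) → Independent a → + (4 ℕ.* ∣ a ∣) + Grow.height (word a) ≡ + suc n
  grow-height []                 _   = refl
  grow-height (true ∷ [])        _   = refl
  grow-height (false ∷ a)        ind =
    trans (step (+ (4 ℕ.* ∣ a ∣)) (Grow.height (word a)))
          (cong (λ z → 1ℤ + z) (grow-height a (independent-tail ind)))
    where step : ∀ k h → k + (1ℤ + h) ≡ 1ℤ + (k + h)
          step = solve-∀
  grow-height (true ∷ false ∷ a) ind = begin
    + (4 ℕ.* suc ∣ a ∣) + (-[1+ 1 ] + h)  ≡⟨ cong (λ k → + k + (-[1+ 1 ] + h)) (*-suc 4 ∣ a ∣) ⟩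
    + 4 + k + (-[1+ 1 ] + h)              ≡⟨ step k h ⟩
    + 2 + (k + h)                         ≡⟨ cong (λ z → + 2 + z) (grow-height a ind′) ⟩
    + 2 + + suc _                         ∎
    where
    open ≡.≡-Reasoning
    h = Grow.height (word a)
    k = + (4 ℕ.* ∣ a ∣)
    ind′ = independent-tail (independent-tail ind)
    step : ∀ k h → + 4 + k + (-[1+ 1 ] + h) ≡ + 2 + (k + h)
    step = solve-∀
  grow-height (true ∷ true ∷ a) ind = ⊥-elim (independent-¬true∷true∷ ind)

  shrink-climbs : ∀ {n} (a : Subset n) → Independent a → n ℕ.+ 2 ℕ.≤ 3 ℕ.* ∣ a ∣ → 1ℤ ≤ Shrink.height (word a)
  shrink-climbs {n} a ind large = +-cancelˡ-≤ (+ suc n) (begin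
    + (suc n ℕ.+ 1)                  ≤⟨ +≤+ (subst (ℕ._≤ 3 ℕ.* ∣ a ∣) (+-suc n 1) large) ⟩
    + (3 ℕ.* ∣ a ∣)                  ≡⟨ sym (shrink-height a ind) ⟩
    + suc n + Shrink.height (word a) ∎)
    where open ≤-Reasoning

  grow-climbs : ∀ {n} (a : Subset n) → Independent a → 4 ℕ.* ∣ a ∣ ℕ.+ 1 ℕ.≤ n → + 2 ≤ Grow.height (word a)
  grow-climbs {n} a ind small = +-cancelˡ-≤ (+ (4 ℕ.* ∣ a ∣)) (begin
    + (4 ℕ.* ∣ a ∣ ℕ.+ 2)                  ≤⟨ +≤+ (subst (ℕ._≤ suc n) (sym (+-suc (4 ℕ.* ∣ a ∣) 1)) (ℕ.s≤s small)) ⟩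
    + suc n                                ≡⟨ sym (grow-height a ind) ⟩
    + (4 ℕ.* ∣ a ∣) + Grow.height (word a) ∎)
    where open ≤-Reasoning

  shrink-ascent : ∀ {t} → 1ℤ ≤ Shrink.height t → Shrink.Ascent (pick ∷ []) t
  shrink-ascent {t} 1≤h = final-step (unsnoc (Summit.top S) (summit-nonempty S (<-≤-trans (+<+ (ℕ.s≤s ℕ.z≤n)) 1≤h)))
    where
    open Shrink
    S = summit t
    final-step : (∃₂ λ u x → u ∷ʳ x ≡ Summit.top S) → Ascent (pick ∷ []) t
    final-step (_ , pick , eq) = summit⇒ascent S (λ ()) eq
    final-step (u , skip , eq) = contradiction (summit-final-rise S u _ eq (λ ())) λ ()

  grow-ascent : ∀ {t} → + 2 ≤ Grow.height t → Grow.Ascent (skip ∷ skip ∷ []) t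
  grow-ascent {t} 2≤h = final-step (unsnoc (Summit.top S) (summit-nonempty S (<-≤-trans (+<+ (ℕ.s≤s ℕ.z≤n)) 2≤h)))
    where
    open Grow
    S = summit t
    final-step : (∃₂ λ u x → u ∷ʳ x ≡ Summit.top S) → Ascent (skip ∷ skip ∷ []) t
    final-step (u , pick , eq) = contradiction (summit-final-rise S u _ eq (λ ())) λ ()
    final-step (u′ , skip , eq) = penultimate-step (unsnoc u′ u′≢[])
      where
      u′≢[] : u′ ≢ []
      u′≢[] refl = contradiction (≤-trans 2≤h (≤-trans (summit-peak S) (≤-reflexive (cong height (sym eq)))))
                                 λ { (+≤+ (ℕ.s≤s ())) }
      penultimate-step : (∃₂ λ u y → u ∷ʳ y ≡ u′) → Ascent (skip ∷ skip ∷ []) t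
      penultimate-step (u , y , eq′)
        with y | trans (sym (++-assoc u (y ∷ []) (skip ∷ []))) (trans (cong (_∷ʳ skip) eq′) eq)
      ... | pick | eq″ = contradiction (summit-final-rise S u _ eq″ (λ ())) λ ()
      ... | skip | eq″ = summit⇒ascent S (λ ()) eq″

  shrink-sinks : Shrink.Sinks (pick ∷ []) (skip ∷ skip ∷ [])
  shrink-sinks []              _ _    []≢[] = contradiction refl []≢[]
  shrink-sinks (_ ∷ [])        _ refl _     = +≤+ ℕ.z≤n
  shrink-sinks (_ ∷ _ ∷ [])    _ refl _     = -≤+
  shrink-sinks (_ ∷ _ ∷ _ ∷ _) _ ()   _

  grow-sinks : Grow.Sinks (skip ∷ skip ∷ []) (pick ∷ [])
  grow-sinks []           _ _    []≢[] = contradiction refl []≢[]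
  grow-sinks (_ ∷ [])     _ refl _     = +≤+ ℕ.z≤n
  grow-sinks (_ ∷ _ ∷ _)  _ ()   _

  module ShrinkWord = Shrink.Replace (skip ∷ skip ∷ []) (λ t → 1ℤ ≤? Shrink.height t) shrink-ascent
  module GrowWord  = Grow.Replace (pick ∷ []) (λ t → + 2 ≤? Grow.height t) grow-ascent

  shrink : ∀ {n} → Subset n → Subset n
  shrink {n} a = decode n (ShrinkWord.replace (word a))

  grow : ∀ {n} → Subset n → Subset n
  grow {n} a = decode n (GrowWord.replace (word a))

  word-injective : ∀ {n} {a b : Subset n} → Independent a → Independent b → word a ≡ word b → a ≡ b
  word-injective {n} {a} {b} ia ib eq = trans (sym (decode-word a ia)) (trans (cong (decode n) eq) (decode-word b ib))

  module _ {n} (a : Subset n) (ind : Independent a) (large : n ℕ.+ 2 ℕ.≤ 3 ℕ.* ∣ a ∣) where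

    shrink-spec : word (shrink a) ≡ ShrinkWord.replace (word a) × shrink a ⊆ a × suc ∣ shrink a ∣ ≡ ∣ a ∣
    shrink-spec with Shrink.ascentAt u v split _ _ , eq ← ShrinkWord.replace-ascent (shrink-climbs a ind large)
      with w≡ , b⊆a , size ← shrink-flip a ind u (sym split) rewrite eq = w≡ , b⊆a , size

  shrink-injective : ∀ {n} {a b : Subset n} → Independent a → Independent b →
    n ℕ.+ 2 ℕ.≤ 3 ℕ.* ∣ a ∣ → n ℕ.+ 2 ℕ.≤ 3 ℕ.* ∣ b ∣ → shrink a ≡ shrink b → a ≡ b
  shrink-injective {a = a} {b} ia ib la lb eq = word-injective ia ib
    (ShrinkWord.replace-injective (λ ()) shrink-sinks (shrink-climbs a ia la) (shrink-climbs b ib lb)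
      (trans (sym (proj₁ (shrink-spec a ia la))) (trans (cong word eq) (proj₁ (shrink-spec b ib lb)))))

  module _ {n} (a : Subset n) (ind : Independent a) (small : 4 ℕ.* ∣ a ∣ ℕ.+ 1 ℕ.≤ n) where

    grow-spec : word (grow a) ≡ GrowWord.replace (word a) × a ⊆ grow a × ∣ grow a ∣ ≡ suc ∣ a ∣
    grow-spec with Grow.ascentAt u v split _ _ , eq ← GrowWord.replace-ascent (grow-climbs a ind small)
      with w≡ , a⊆b , size ← grow-flip a ind u (sym split) rewrite eq = w≡ , a⊆b , size

  grow-injective : ∀ {n} {a b : Subset n} → Independent a → Independent b →
    4 ℕ.* ∣ a ∣ ℕ.+ 1 ℕ.≤ n → 4 ℕ.* ∣ b ∣ ℕ.+ 1 ℕ.≤ n → grow a ≡ grow b → a ≡ b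
  grow-injective {a = a} {b} ia ib sa sb eq = word-injective ia ib
    (GrowWord.replace-injective (λ ()) grow-sinks (grow-climbs a ia sa) (grow-climbs b ib sb)
      (trans (sym (proj₁ (grow-spec a ia sa))) (trans (cong word eq) (proj₁ (grow-spec b ib sb)))))

open IndependentSets using (shrink; grow; shrink-spec; grow-spec; shrink-injective; grow-injective; decode-independent)

open import Data.Nat using (_+_; _*_; _∸_; _≤_; _<_; _≟_; _<?_; pred; z≤n; s≤s)
open import Data.Nat.Properties
  using (≤-refl; ≤-reflexive; ≤-trans; ≤-<-trans; <-≤-trans; ≤-pred; ≤∧≢⇒<; ≮⇒≥; 1+n≰n; +-suc; m≤m+n; m≤n+m;
         m<m+n; +-monoˡ-≤; *-monoʳ-≤; ∸-monoʳ-≤; m∸n≤m; m∸[m∸n]≡n; pred[m∸n]≡m∸[1+n])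
open import Data.Nat.Tactic.RingSolver using (solve-∀)

length-filter-∁ : ∀ {A : Set} {P : A → Set} (P? : Decidable P) xs →
  length (filter (∁? P?) xs) + length (filter P? xs) ≡ length xs
length-filter-∁ P? []       = refl
length-filter-∁ P? (x ∷ xs) with P? x
... | yes _ = trans (+-suc (length (filter (∁? P?) xs)) _) (cong suc (length-filter-∁ P? xs))
... | no  _ = cong suc (length-filter-∁ P? xs)

map-unique : ∀ {A B : Set} {Q : A → Set} (f : A → B) → (∀ {a b} → Q a → Q b → f a ≡ f b → a ≡ b) →
  ∀ {xs} → All Q xs → Unique xs → Unique (map f xs)
map-unique {Q = Q} f inj []                 []           = []
map-unique {Q = Q} f inj {a ∷ _} (qa ∷ qas) (a∉ ∷ uniq) = distinct qas a∉ ∷ map-unique f inj qas uniq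
  where
  distinct : ∀ {ys} → All Q ys → All (a ≢_) ys → All (f a ≢_) (map f ys)
  distinct []         []           = []
  distinct (qb ∷ qbs) (a≢b ∷ a≢bs) = (λ fa≡fb → a≢b (inj qa qb fa≡fb)) ∷ distinct qbs a≢bs

module Compression {S : Set} (_⊑_ : S → S → Set) (⊑-trans : ∀ {a b c} → a ⊑ b → b ⊑ c → a ⊑ c)
                   (rank : S → ℕ) (rank-rigid : ∀ {a b} → a ⊑ b → rank b ≤ rank a → a ≡ b)
                   (P : S → Set) where

  IsAntichain : List S → Set
  IsAntichain F = ∀ {a b} → a ∈ F → b ∈ F → a ⊑ b → a ≡ b

  record Admissible (B : ℕ → Set) (F : List S) : Set where
    field
      unique    : Unique F
      valid     : All P F
      antichain : IsAntichain F
      bounded   : All (B ∘ rank) F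

  record LayerInjection (R : ℕ) : Set where
    field
      f           : S → S
      f-below     : ∀ {a} → P a → rank a ≡ suc R → f a ⊑ a
      f-rank      : ∀ {a} → P a → rank a ≡ suc R → rank (f a) ≡ R
      f-valid     : ∀ {a} → P a → rank a ≡ suc R → P (f a)
      f-injective : ∀ {a b} → P a → P b → rank a ≡ suc R → rank b ≡ suc R → f a ≡ f b → a ≡ b

  compress : ∀ {R F} → LayerInjection R → Admissible (_≤ suc R) F →
    ∃ λ F′ → Admissible (_≤ R) F′ × length F ≤ length F′
  compress {R} {F} L A = lower ++ map f upper , admissible , ≤-reflexive (sym size)
    where
    open LayerInjection L
    open Admissible A

    Top : S → Set
    Top a = rank a ≡ suc R

    top? : Decidable Top
    top? a = rank a ≟ suc R

    upper lower : List S
    upper = filter top? F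
    lower = filter (∁? top?) F

    ∈-upper : ∀ {a} → a ∈ upper → a ∈ F × P a × Top a
    ∈-upper a∈ with a∈F , top ← ∈-filter⁻ top? a∈ = a∈F , All.lookup valid a∈F , top

    ∈-lower : ∀ {a} → a ∈ lower → a ∈ F × ¬ Top a
    ∈-lower = ∈-filter⁻ (∁? top?)

    lower-rank : ∀ {a} → a ∈ lower → rank a ≤ R
    lower-rank a∈ with a∈F , ¬top ← ∈-lower a∈ = ≤-pred (≤∧≢⇒< (All.lookup bounded a∈F) ¬top)

    ∈-image : ∀ {b} → b ∈ map f upper → ∃ λ a → b ≡ f a × a ∈ F × P a × Top a
    ∈-image b∈ with a , a∈ , refl ← ∈-map⁻ f b∈ = a , refl , ∈-upper a∈

    upper-props : All (λ a → P a × Top a) upper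
    upper-props = All.tabulate λ a∈ → let _ , pa , top = ∈-upper a∈ in pa , top

    disjoint : ∀ {b} → ¬ (b ∈ lower × b ∈ map f upper)
    disjoint (b∈lower , b∈image) with ∈-image b∈image
    ... | a , refl , a∈F , pa , top with b∈F , ¬top ← ∈-lower b∈lower =
      ¬top (trans (cong rank (antichain b∈F a∈F (f-below pa top))) top)

    antichain′ : IsAntichain (lower ++ map f upper)
    antichain′ a∈ b∈ a⊑b with ∈-++⁻ lower a∈ | ∈-++⁻ lower b∈
    ... | inj₁ a∈lower | inj₁ b∈lower = antichain (proj₁ (∈-lower a∈lower)) (proj₁ (∈-lower b∈lower)) a⊑b
    ... | inj₁ a∈lower | inj₂ b∈image with b , refl , b∈F , pb , top ← ∈-image b∈image
      with a∈F , ¬top ← ∈-lower a∈lower =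
      contradiction (trans (cong rank (antichain a∈F b∈F (⊑-trans a⊑b (f-below pb top)))) top) ¬top
    ... | inj₂ a∈image | inj₁ b∈lower with a , refl , _ , pa , top ← ∈-image a∈image =
      rank-rigid a⊑b (≤-trans (lower-rank b∈lower) (≤-reflexive (sym (f-rank pa top))))
    ... | inj₂ a∈image | inj₂ b∈image with a , refl , _ , pa , ta ← ∈-image a∈image
                                      | b , refl , _ , pb , tb ← ∈-image b∈image =
      rank-rigid a⊑b (≤-reflexive (trans (f-rank pb tb) (sym (f-rank pa ta))))

    admissible : Admissible (_≤ R) (lower ++ map f upper)
    admissible = record
      { unique    = Unique.++⁺ (Unique.filter⁺ (∁? top?) unique)
                               (map-unique f (λ (pa , ta) (pb , tb) → f-injective pa pb ta tb) upper-props
                                           (Unique.filter⁺ top? unique))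
                               disjoint
      ; valid     = All.++⁺ (All.filter⁺ (∁? top?) valid)
                            (All.map⁺ (All.map (λ (pa , ta) → f-valid pa ta) upper-props))
      ; antichain = antichain′
      ; bounded   = All.++⁺ (All.tabulate lower-rank)
                            (All.map⁺ (All.map (λ (pa , ta) → ≤-reflexive (f-rank pa ta)) upper-props))
      }

    size : length (lower ++ map f upper) ≡ length F
    size = trans (length-++ lower) (trans (cong (length lower +_) (length-map f upper)) (length-filter-∁ top? F))

  compress-until : (Good : ℕ → Set) → Decidable Good → Good 0 → (∀ {m k} → m ≤ k → Good k → Good m) →
    (∀ R → ¬ Good (suc R) → LayerInjection R) →
    ∀ k {F} → Admissible (_≤ k) F → ∃ λ F′ → Admissible Good F′ × length F ≤ length F′
  compress-until Good Good? good₀ good-↓ inject = go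
    where
    settle : ∀ {k F} → Good k → Admissible (_≤ k) F → Admissible Good F
    settle good A = record
      { unique = unique ; valid = valid ; antichain = antichain
      ; bounded = All.map (λ r≤k → good-↓ r≤k good) bounded }
      where open Admissible A

    go : ∀ k {F} → Admissible (_≤ k) F → ∃ λ F′ → Admissible Good F′ × length F ≤ length F′
    go zero    A = _ , settle good₀ A , ≤-refl
    go (suc R) A with Good? (suc R)
    ... | yes good = _ , settle good A , ≤-refl
    ... | no ¬good with F₁ , A₁ , l₁ ← compress (inject R ¬good) A with F₂ , A₂ , l₂ ← go R A₁ =
      F₂ , A₂ , ≤-trans l₁ l₂

⊆-rigid : ∀ {n} {a b : Subset n} → a ⊆ b → ∣ b ∣ ≤ ∣ a ∣ → a ≡ b
⊆-rigid {a = []}        {[]}        _   _  = refl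
⊆-rigid {a = true ∷ a}  {true ∷ b}  a⊆b le = cong (true ∷_) (⊆-rigid (drop-∷-⊆ a⊆b) (≤-pred le))
⊆-rigid {a = false ∷ a} {false ∷ b} a⊆b le = cong (false ∷_) (⊆-rigid (drop-∷-⊆ a⊆b) le)
⊆-rigid {a = true ∷ a}  {false ∷ b} a⊆b _  with () ← a⊆b here
⊆-rigid {a = false ∷ a} {true ∷ b}  a⊆b le = contradiction (≤-trans le (p⊆q⇒∣p∣≤∣q∣ (drop-∷-⊆ a⊆b))) 1+n≰n

grow-stays-below : ∀ {n} r → 4 * r + 1 ≤ n → 2 ≤ n → 3 * suc r < n + 2
grow-stays-below zero    _     2≤n = +-monoˡ-≤ 2 2≤n
grow-stays-below (suc r) small _   = ≤-trans (subst (suc (3 * suc (suc r)) ≤_) (sym (rearrange r)) (m≤m+n _ r))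
                                              (+-monoˡ-≤ 2 small)
  where rearrange : ∀ r → 4 * suc r + 1 + 2 ≡ suc (3 * suc (suc r)) + r
        rearrange = solve-∀

module _ (n : ℕ) where

  module Downward = Compression _⊆_ ⊆-trans ∣_∣ ⊆-rigid (Independent {n})

  shrink-injection : ∀ R → n + 2 ≤ 3 * suc R → Downward.LayerInjection R
  shrink-injection R large = record
    { f           = shrink
    ; f-below     = λ {a} ind size → proj₁ (proj₂ (shrink-spec a ind (large′ a size)))
    ; f-rank      = λ {a} ind size → cong pred (trans (proj₂ (proj₂ (shrink-spec a ind (large′ a size)))) size)
    ; f-valid     = λ _ _ → decode-independent n _
    ; f-injective = λ {a} {b} ia ib sa sb → shrink-injective ia ib (large′ a sa) (large′ b sb)
    }
    where large′ : ∀ (a : Subset n) → ∣ a ∣ ≡ suc R → n + 2 ≤ 3 * ∣ a ∣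
          large′ _ size = subst (λ k → n + 2 ≤ 3 * k) (sym size) large

  -- The upward pass is the downward one for ⊇, ranked by the number of absent vertices.
  coSize : Subset n → ℕ
  coSize a = n ∸ ∣ a ∣

  coSize-rigid : ∀ {a b : Subset n} → a ⊇ b → coSize b ≤ coSize a → a ≡ b
  coSize-rigid {a} {b} b⊆a le = sym (⊆-rigid b⊆a (sizes (∸-monoʳ-≤ n le)))
    where
    sizes : n ∸ coSize a ≤ n ∸ coSize b → ∣ a ∣ ≤ ∣ b ∣
    sizes = subst (_≤ ∣ b ∣) (m∸[m∸n]≡n (∣p∣≤n a)) ∘ subst (n ∸ coSize a ≤_) (m∸[m∸n]≡n (∣p∣≤n b))

  LowIndependent : Subset n → Set
  LowIndependent a = Independent a × 3 * ∣ a ∣ < n + 2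

  module Upward = Compression _⊇_ (λ c⊆b b⊆a → ⊆-trans b⊆a c⊆b) coSize coSize-rigid LowIndependent

  grow-injection : ∀ R → 4 * (n ∸ suc R) + 1 ≤ n → 2 ≤ n → Upward.LayerInjection R
  grow-injection R small 2≤n = record
    { f           = grow
    ; f-below     = λ {a} (ind , _) co → proj₁ (proj₂ (grow-spec a ind (small′ a co)))
    ; f-rank      = λ {a} (ind , _) co → trans (cong (n ∸_) (proj₂ (proj₂ (grow-spec a ind (small′ a co)))))
                                          (trans (sym (pred[m∸n]≡m∸[1+n] n ∣ a ∣)) (cong pred co))
    ; f-valid     = λ {a} (ind , _) co → decode-independent n _ ,
                      subst (λ k → 3 * k < n + 2) (sym (proj₂ (proj₂ (grow-spec a ind (small′ a co)))))
                            (grow-stays-below ∣ a ∣ (small′ a co) 2≤n)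
    ; f-injective = λ {a} {b} (ia , _) (ib , _) ca cb → grow-injective ia ib (small′ a ca) (small′ b cb)
    }
    where small′ : ∀ (a : Subset n) → coSize a ≡ suc R → 4 * ∣ a ∣ + 1 ≤ n
          small′ a co = subst (λ k → 4 * k + 1 ≤ n) (trans (cong (n ∸_) (sym co)) (m∸[m∸n]≡n (∣p∣≤n a))) small

  BelowMiddle : ℕ → Set
  BelowMiddle r = 3 * r < n + 2

  AboveMiddle : ℕ → Set
  AboveMiddle m = n < 4 * (n ∸ m) + 1

  push-down : ∀ {F} → Downward.Admissible (_≤ n) F →
    Σ (List (Subset n)) λ F′ → Downward.Admissible BelowMiddle F′ × length F ≤ length F′
  push-down = Downward.compress-until BelowMiddle (λ r → 3 * r <? n + 2) (≤-trans (s≤s z≤n) (m≤n+m 2 n))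
    (λ m≤k below → ≤-<-trans (*-monoʳ-≤ 3 m≤k) below)
    (λ R ¬below → shrink-injection R (≮⇒≥ ¬below)) n

  push-up : 2 ≤ n → ∀ {F} → Downward.Admissible BelowMiddle F →
    Σ (List (Subset n)) λ F′ → Upward.Admissible AboveMiddle F′ × length F ≤ length F′
  push-up 2≤n A = Upward.compress-until AboveMiddle (λ m → n <? 4 * (n ∸ m) + 1)
    (≤-<-trans (m≤m+n n (3 * n)) (m<m+n (4 * n) (s≤s z≤n)))
    (λ m≤k above → <-≤-trans above (+-monoˡ-≤ 1 (*-monoʳ-≤ 4 (∸-monoʳ-≤ n m≤k))))
    (λ R ¬above → grow-injection R (≮⇒≥ ¬above) 2≤n) n
    (record { unique = unique ; valid = All.zip (valid , bounded)
            ; antichain = λ a∈ b∈ b⊆a → sym (antichain b∈ a∈ b⊆a)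
            ; bounded = All.tabulate λ {a} _ → m∸n≤m n ∣ a ∣ })
    where open Downward.Admissible A

lemma10 : (n : ℕ) → 2 ≤ n → (𝒜 : List (Subset n)) → InQ n 𝒜 → Antichain 𝒜 →
    Σ (List (Subset n)) (λ 𝒜' → Unique 𝒜' × All (InQ' n) 𝒜' × Antichain 𝒜' × length 𝒜 ≤ length 𝒜')
lemma10 n 2≤n 𝒜 (unique , independent) antichain
  with F₁ , A₁ , l₁ ← push-down n (record { unique = unique ; valid = independent ; antichain = antichain
                                                     ; bounded = All.tabulate λ {a} _ → ∣p∣≤n a })
  with F₂ , A₂ , l₂ ← push-up n 2≤n A₁ =
  F₂ , unique′ , All.zipWith middle (valid′ , bounded′) , (λ a∈ b∈ a⊆b → sym (antichain′ b∈ a∈ a⊆b)) , ≤-trans l₁ l₂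
  where
  open Upward.Admissible n A₂
    renaming (unique to unique′; valid to valid′; antichain to antichain′; bounded to bounded′)
  middle : ∀ {a} → LowIndependent n a × AboveMiddle n (coSize n a) → InQ' n a
  middle {a} ((ind , below) , above) = ind , subst (λ k → n < 4 * k + 1) (m∸[m∸n]≡n (∣p∣≤n a)) above , below
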